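{- Over the language $\langle\land,\lor,\Rightarrow,\neg,0,1\rangle$, where in $\mathcal N3$ the connective $\Rightarrow$ is the strong implication, Nelson logic $\mathcal N3$ is a proper strengthening of Nelson's logic $\mathcal S$: whenever $\Gamma\vdash_{\mathcal S}\varphi$ we have $\Gamma\vdash_{\mathcal N3}\varphi$, but not conversely.
   Context: $\mathcal N4$ is the logic in the language $\langle\land,\lor,\to,\neg\rangle$ given by modus ponens for $\to$ and the axiom schemata (with $\varphi\leftrightarrow\psi:=(\varphi\to\psi)\land(\psi\to\varphi)$): (N1) $\phi\to(\psi\to\phi)$; (N2) $(\phi\to(\psi\to\gamma))\to((\phi\to\psi)\to(\phi\to\gamma))$; (N3) $(\phi\land\psi)\to\phi$; (N4) $(\phi\land\psi)\to\psi$; (N5) $(\phi\to\psi)\to((\phi\to\gamma)\to(\phi\to(\psi\land\gamma)))$; (N6) $\phi\to(\phi\lor\psi)$; (N7) $\psi\to(\phi\lor\psi)$; (N8) $(\phi\to\gamma)\to((\psi\to\gamma)\to((\phi\lor\psi)\to\gamma))$; (N9) $\neg\neg\phi\leftrightarrow\phi$; (N10) $\neg(\phi\lor\psi)\leftrightarrow(\neg\phi\land\neg\psi)$; (N11) $\neg(\phi\land\psi)\leftrightarrow(\neg\phi\lor\neg\psi)$; (N12) $\neg(\phi\to\psi)\leftrightarrow(\phi\land\neg\psi)$. Nelson logic $\mathcal N3$ is $\mathcal N4$ plus the axiom schema (N13) $\neg\phi\to(\phi\to\psi)$. In $\mathcal N3$ the strong implication is $\varphi\Rightarrow\psi:=(\varphi\to\psi)\land(\neg\psi\to\neg\varphi)$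 and the constants are term-definable by $1:=p\to p$ (for a fixed variable $p$) and $0:=\neg1$. Nelson's logic $\mathcal S$ is the sentential logic in the language $\langle\land,\lor,\Rightarrow,\neg,0\rangle$ (with $1:=\neg0$) given by the following Hilbert-style calculus. Abbreviations: $\phi\Leftrightarrow\psi:=(\phi\Rightarrow\psi)\land(\psi\Rightarrow\phi)$, $\phi\Rightarrow^2\psi:=\phi\Rightarrow(\phi\Rightarrow\psi)$; for a finite (possibly empty) list $\Gamma=(\phi_1,\dots,\phi_n)$, $\Gamma\Rightarrow\phi:=\phi_1\Rightarrow(\phi_2\Rightarrow(\cdots(\phi_n\Rightarrow\phi)\cdots))$ and $\Gamma\Rightarrow^2\phi:=\phi_1\Rightarrow^2(\cdots(\phi_n\Rightarrow^2\phi)\cdots)$, both $\phi$ if $\Gamma$ is empty. Axioms: (A1) $\phi\Rightarrow\phi$; (A2) $0\Rightarrow\psi$; (A3) $\neg\phi\Rightarrow(\phi\Rightarrow0)$; (A4) $1$; (A5) $(\phi\Rightarrow\psi)\Leftrightarrow(\neg\psi\Rightarrow\neg\phi)$. Rules ("premisses / conclusion", for every finite list $\Gamma$): (P) $\Gamma\Rightarrow(\phi\Rightarrow(\psi\Rightarrow\gamma))$ / $\Gamma\Rightarrow(\psi\Rightarrow(\phi\Rightarrow\gamma))$; (C) $\phi\Rightarrow(\phi\Rightarrow(\phi\Rightarrow\gamma))$ / $\phi\Rightarrow(\phi\Rightarrow\gamma)$; (E) $\Gamma\Rightarrow\phi$, $\phi\Rightarrow\gamma$ / $\Gamma\Rightarrow\gamma$;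 ($\Rightarrow$l) $\Gamma\Rightarrow\phi$, $\psi\Rightarrow\gamma$ / $\Gamma\Rightarrow((\phi\Rightarrow\psi)\Rightarrow\gamma)$; ($\Rightarrow$r) $\gamma$ / $\phi\Rightarrow\gamma$; ($\land$l1) $\phi\Rightarrow\gamma$ / $(\phi\land\psi)\Rightarrow\gamma$; ($\land$l2) $\psi\Rightarrow\gamma$ / $(\phi\land\psi)\Rightarrow\gamma$; ($\land$r) $\Gamma\Rightarrow\phi$, $\Gamma\Rightarrow\psi$ / $\Gamma\Rightarrow(\phi\land\psi)$; ($\lor$l1) $\phi\Rightarrow\gamma$, $\psi\Rightarrow\gamma$ / $(\phi\lor\psi)\Rightarrow\gamma$; ($\lor$l2) $\phi\Rightarrow^2\gamma$, $\psi\Rightarrow^2\gamma$ / $(\phi\lor\psi)\Rightarrow^2\gamma$; ($\lor$r1) $\Gamma\Rightarrow\phi$ / $\Gamma\Rightarrow(\phi\lor\psi)$; ($\lor$r2) $\Gamma\Rightarrow\psi$ / $\Gamma\Rightarrow(\phi\lor\psi)$; ($\neg\Rightarrow$l) $(\phi\land\neg\psi)\Rightarrow\gamma$ / $\neg(\phi\Rightarrow\psi)\Rightarrow\gamma$; ($\neg\Rightarrow$r) $\Gamma\Rightarrow^2(\phi\land\neg\psi)$ / $\Gamma\Rightarrow^2\neg(\phi\Rightarrow\psi)$; ($\neg\land$l) $(\neg\phi\lor\neg\psi)\Rightarrow\gamma$ / $\neg(\phi\land\psi)\Rightarrow\gamma$; ($\neg\land$r) $\Gamma\Rightarrow(\neg\phi\lor\neg\psi)$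 / $\Gamma\Rightarrow\neg(\phi\land\psi)$; ($\neg\lor$l) $(\neg\phi\land\neg\psi)\Rightarrow\gamma$ / $\neg(\phi\lor\psi)\Rightarrow\gamma$; ($\neg\lor$r) $\Gamma\Rightarrow(\neg\phi\land\neg\psi)$ / $\Gamma\Rightarrow\neg(\phi\lor\psi)$; ($\neg\neg$l) $\phi\Rightarrow\gamma$ / $\neg\neg\phi\Rightarrow\gamma$; ($\neg\neg$r) $\Gamma\Rightarrow\phi$ / $\Gamma\Rightarrow\neg\neg\phi$. -}

module Defs where

open import Data.Nat using (ℕ)
open import Data.List using (List; []; _∷_; foldr)
open import Data.Product using (Σ; _×_)
open import Relation.Binary.PropositionalEquality using (_≡_)

infixr 5 _⇒_
infixr 6 _∨_
infixr 7 _∧_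
infix 8 ¬_
infixr 5 _⇔_ _⇒²_ _⇒*_ _⇒²*_

data SFm : Set where
  var : ℕ → SFm
  _∧_ _∨_ _⇒_ : SFm → SFm → SFm
  ¬_  : SFm → SFm
  𝟘   : SFm

𝟙 : SFm
𝟙 = ¬ 𝟘

_⇔_ : SFm → SFm → SFm
φ ⇔ ψ = (φ ⇒ ψ) ∧ (ψ ⇒ φ)

_⇒²_ : SFm → SFm → SFm
φ ⇒² ψ = φ ⇒ (φ ⇒ ψ)

_⇒*_ : List SFm → SFm → SFm
Γ ⇒* φ = foldr _⇒_ φ Γ

_⇒²*_ : List SFm → SFm → SFm
Γ ⇒²* φ = foldr _⇒²_ φ Γ

data _⊢S_ (Γ : SFm → Set) : SFm → Set where
  prem : ∀ {φ} → Γ φ → Γ ⊢S φ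
  A1 : ∀ φ → Γ ⊢S (φ ⇒ φ)
  A2 : ∀ ψ → Γ ⊢S (𝟘 ⇒ ψ)
  A3 : ∀ φ → Γ ⊢S (¬ φ ⇒ (φ ⇒ 𝟘))
  A4 : Γ ⊢S 𝟙
  A5 : ∀ φ ψ → Γ ⊢S ((φ ⇒ ψ) ⇔ (¬ ψ ⇒ ¬ φ))
  P  : ∀ Δ φ ψ γ → Γ ⊢S (Δ ⇒* (φ ⇒ (ψ ⇒ γ))) → Γ ⊢S (Δ ⇒* (ψ ⇒ (φ ⇒ γ)))
  C  : ∀ φ γ → Γ ⊢S (φ ⇒ (φ ⇒ (φ ⇒ γ))) → Γ ⊢S (φ ⇒ (φ ⇒ γ))
  E  : ∀ Δ φ γ → Γ ⊢S (Δ ⇒* φ) → Γ ⊢S (φ ⇒ γ) → Γ ⊢S (Δ ⇒* γ)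
  ⇒l : ∀ Δ φ ψ γ → Γ ⊢S (Δ ⇒* φ) → Γ ⊢S (ψ ⇒ γ) → Γ ⊢S (Δ ⇒* ((φ ⇒ ψ) ⇒ γ))
  ⇒r : ∀ φ γ → Γ ⊢S γ → Γ ⊢S (φ ⇒ γ)
  ∧l1 : ∀ φ ψ γ → Γ ⊢S (φ ⇒ γ) → Γ ⊢S ((φ ∧ ψ) ⇒ γ)
  ∧l2 : ∀ φ ψ γ → Γ ⊢S (ψ ⇒ γ) → Γ ⊢S ((φ ∧ ψ) ⇒ γ)
  ∧r  : ∀ Δ φ ψ → Γ ⊢S (Δ ⇒* φ) → Γ ⊢S (Δ ⇒* ψ) → Γ ⊢S (Δ ⇒* (φ ∧ ψ))
  ∨l1 : ∀ φ ψ γ → Γ ⊢S (φ ⇒ γ) → Γ ⊢S (ψ ⇒ γ) → Γ ⊢S ((φ ∨ ψ) ⇒ γ)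
  ∨l2 : ∀ φ ψ γ → Γ ⊢S (φ ⇒² γ) → Γ ⊢S (ψ ⇒² γ) → Γ ⊢S ((φ ∨ ψ) ⇒² γ)
  ∨r1 : ∀ Δ φ ψ → Γ ⊢S (Δ ⇒* φ) → Γ ⊢S (Δ ⇒* (φ ∨ ψ))
  ∨r2 : ∀ Δ φ ψ → Γ ⊢S (Δ ⇒* ψ) → Γ ⊢S (Δ ⇒* (φ ∨ ψ))
  ¬⇒l : ∀ φ ψ γ → Γ ⊢S ((φ ∧ ¬ ψ) ⇒ γ) → Γ ⊢S (¬ (φ ⇒ ψ) ⇒ γ)
  ¬⇒r : ∀ Δ φ ψ → Γ ⊢S (Δ ⇒²* (φ ∧ ¬ ψ)) → Γ ⊢S (Δ ⇒²* ¬ (φ ⇒ ψ))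
  ¬∧l : ∀ φ ψ γ → Γ ⊢S ((¬ φ ∨ ¬ ψ) ⇒ γ) → Γ ⊢S (¬ (φ ∧ ψ) ⇒ γ)
  ¬∧r : ∀ Δ φ ψ → Γ ⊢S (Δ ⇒* (¬ φ ∨ ¬ ψ)) → Γ ⊢S (Δ ⇒* ¬ (φ ∧ ψ))
  ¬∨l : ∀ φ ψ γ → Γ ⊢S ((¬ φ ∧ ¬ ψ) ⇒ γ) → Γ ⊢S (¬ (φ ∨ ψ) ⇒ γ)
  ¬∨r : ∀ Δ φ ψ → Γ ⊢S (Δ ⇒* (¬ φ ∧ ¬ ψ)) → Γ ⊢S (Δ ⇒* ¬ (φ ∨ ψ))
  ¬¬l : ∀ φ γ → Γ ⊢S (φ ⇒ γ) → Γ ⊢S (¬ ¬ φ ⇒ γ)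
  ¬¬r : ∀ Δ φ → Γ ⊢S (Δ ⇒* φ) → Γ ⊢S (Δ ⇒* ¬ ¬ φ)

infixr 5 _⟶_
infixr 6 _∨ₙ_
infixr 7 _∧ₙ_
infix 8 ¬ₙ_
infixr 5 _⟷_ _⇛_

data NFm : Set where
  var : ℕ → NFm
  _∧ₙ_ _∨ₙ_ _⟶_ : NFm → NFm → NFm
  ¬ₙ_ : NFm → NFm

_⟷_ : NFm → NFm → NFm
φ ⟷ ψ = (φ ⟶ ψ) ∧ₙ (ψ ⟶ φ)

-- Derivability in N3 (= N4 + N13) from a set of premisses Γ, with modus ponens
data _⊢N3_ (Γ : NFm → Set) : NFm → Set where
  prem : ∀ {φ} → Γ φ → Γ ⊢N3 φ
  mp   : ∀ {φ ψ} → Γ ⊢N3 (φ ⟶ ψ) → Γ ⊢N3 φ → Γ ⊢N3 ψ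
  N1  : ∀ φ ψ → Γ ⊢N3 (φ ⟶ (ψ ⟶ φ))
  N2  : ∀ φ ψ γ → Γ ⊢N3 ((φ ⟶ (ψ ⟶ γ)) ⟶ ((φ ⟶ ψ) ⟶ (φ ⟶ γ)))
  N3  : ∀ φ ψ → Γ ⊢N3 ((φ ∧ₙ ψ) ⟶ φ)
  N4  : ∀ φ ψ → Γ ⊢N3 ((φ ∧ₙ ψ) ⟶ ψ)
  N5  : ∀ φ ψ γ → Γ ⊢N3 ((φ ⟶ ψ) ⟶ ((φ ⟶ γ) ⟶ (φ ⟶ (ψ ∧ₙ γ))))
  N6  : ∀ φ ψ → Γ ⊢N3 (φ ⟶ (φ ∨ₙ ψ))
  N7  : ∀ φ ψ → Γ ⊢N3 (ψ ⟶ (φ ∨ₙ ψ))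
  N8  : ∀ φ ψ γ → Γ ⊢N3 ((φ ⟶ γ) ⟶ ((ψ ⟶ γ) ⟶ ((φ ∨ₙ ψ) ⟶ γ)))
  N9  : ∀ φ → Γ ⊢N3 (¬ₙ ¬ₙ φ ⟷ φ)
  N10 : ∀ φ ψ → Γ ⊢N3 (¬ₙ (φ ∨ₙ ψ) ⟷ (¬ₙ φ ∧ₙ ¬ₙ ψ))
  N11 : ∀ φ ψ → Γ ⊢N3 (¬ₙ (φ ∧ₙ ψ) ⟷ (¬ₙ φ ∨ₙ ¬ₙ ψ))
  N12 : ∀ φ ψ → Γ ⊢N3 (¬ₙ (φ ⟶ ψ) ⟷ (φ ∧ₙ ¬ₙ ψ))
  N13 : ∀ φ ψ → Γ ⊢N3 (¬ₙ φ ⟶ (φ ⟶ ψ))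

_⇛_ : NFm → NFm → NFm
φ ⇛ ψ = (φ ⟶ ψ) ∧ₙ (¬ₙ ψ ⟶ ¬ₙ φ)

𝟙ₙ : NFm
𝟙ₙ = var 0 ⟶ var 0

𝟘ₙ : NFm
𝟘ₙ = ¬ₙ 𝟙ₙ

tr : SFm → NFm
tr (var n) = var n
tr (φ ∧ ψ) = tr φ ∧ₙ tr ψ
tr (φ ∨ ψ) = tr φ ∨ₙ tr ψ
tr (φ ⇒ ψ) = tr φ ⇛ tr ψ
tr (¬ φ)   = ¬ₙ tr φ
tr 𝟘       = 𝟘ₙ

trSet : (SFm → Set) → NFm → Set
trSet Γ ψ = Σ SFm (λ χ → Γ χ × tr χ ≡ ψ)

-- Translate ⇒ as the strong implication A ⇛ B = (A → B) ∧ (¬B → ¬A)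
-- and 0 as ¬(p → p).  Every axiom of S becomes an N3-theorem and every rule of
-- S preserves N3-derivability.
--
-- On the six-element chain v0 < … < v5 with its order involution
-- there is a commutative monoid whose residuum makes it a model of S: every
-- axiom evaluates to the top v5 and every rule preserves this (the finitely
-- many algebraic facts involved are checked by exhaustion).  In this model
-- p ⇒ (p ⇒ q) and ¬q ⇒ (¬q ⇒ ¬p) are designated while p ⇒ q is not, so S does
-- not derive p ⇒ q from them; N3 does, since its weak implication contracts.
module Submission where

open import Defs
open import Data.Product using (Σ; _×_; _,_)
open import Relation.Nullary renaming (¬_ to Not)

open import Data.Bool using (if_then_else_)
open import Data.Fin using (Fin; zero; suc; toℕ; opposite)
open import Data.Fin.Properties using (all?; _≟_; opposite-involutive)
open import Data.List using (List; []; _∷_)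
open import Data.Nat using (ℕ; _≤ᵇ_)
open import Data.Sum using (_⊎_; inj₁; inj₂)
open import Relation.Binary.PropositionalEquality using (_≡_; refl; sym; trans; cong; cong₂; module ≡-Reasoning)
open import Relation.Nullary.Decidable using (from-yes; _→-dec_)

private variable
  Γ Γ′ : NFm → Set
  A B W X Y Z : NFm

infixl 4 _▸_
_▸_ : (NFm → Set) → NFm → NFm → Set
(Γ ▸ A) ψ = Γ ψ ⊎ A ≡ ψ

weaken : (∀ {ψ} → Γ ψ → Γ′ ψ) → Γ ⊢N3 X → Γ′ ⊢N3 X
weaken f (prem x)    = prem (f x)
weaken f (mp d e)    = mp (weaken f d) (weaken f e)
weaken f (N1 a b)    = N1 a b
weaken f (N2 a b c)  = N2 a b c
weaken f (N3 a b)    = N3 a b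
weaken f (N4 a b)    = N4 a b
weaken f (N5 a b c)  = N5 a b c
weaken f (N6 a b)    = N6 a b
weaken f (N7 a b)    = N7 a b
weaken f (N8 a b c)  = N8 a b c
weaken f (N9 a)      = N9 a
weaken f (N10 a b)   = N10 a b
weaken f (N11 a b)   = N11 a b
weaken f (N12 a b)   = N12 a b
weaken f (N13 a b)   = N13 a b

wk : Γ ⊢N3 X → (Γ ▸ A) ⊢N3 X
wk = weaken inj₁

hyp : (Γ ▸ A) ⊢N3 A
hyp = prem (inj₂ refl)

-- A → A, from N1 and N2 as the combinator S K K.
⟶-refl : ∀ A → Γ ⊢N3 (A ⟶ A)
⟶-refl A = mp (mp (N2 A (A ⟶ A) A) (N1 A (A ⟶ A))) (N1 A A)

⟶-const : Γ ⊢N3 X → Γ ⊢N3 (A ⟶ X)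
⟶-const d = mp (N1 _ _) d

deduction : (Γ ▸ A) ⊢N3 B → Γ ⊢N3 (A ⟶ B)
deduction (prem (inj₁ x))            = ⟶-const (prem x)
deduction {A = A} (prem (inj₂ refl)) = ⟶-refl A
deduction (mp d e)   = mp (mp (N2 _ _ _) (deduction d)) (deduction e)
deduction (N1 a b)   = ⟶-const (N1 a b)
deduction (N2 a b c) = ⟶-const (N2 a b c)
deduction (N3 a b)   = ⟶-const (N3 a b)
deduction (N4 a b)   = ⟶-const (N4 a b)
deduction (N5 a b c) = ⟶-const (N5 a b c)
deduction (N6 a b)   = ⟶-const (N6 a b)
deduction (N7 a b)   = ⟶-const (N7 a b)
deduction (N8 a b c) = ⟶-const (N8 a b c)
deduction (N9 a)     = ⟶-const (N9 a)
deduction (N10 a b)  = ⟶-const (N10 a b)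
deduction (N11 a b)  = ⟶-const (N11 a b)
deduction (N12 a b)  = ⟶-const (N12 a b)
deduction (N13 a b)  = ⟶-const (N13 a b)

∧-intro : Γ ⊢N3 A → Γ ⊢N3 B → Γ ⊢N3 (A ∧ₙ B)
∧-intro {A = A} {B = B} a b = mp (mp (mp (N5 A A B) (⟶-refl A)) (⟶-const b)) a

∧-elim₁ : Γ ⊢N3 (A ∧ₙ B) → Γ ⊢N3 A
∧-elim₁ = mp (N3 _ _)

∧-elim₂ : Γ ⊢N3 (A ∧ₙ B) → Γ ⊢N3 B
∧-elim₂ = mp (N4 _ _)

∨-intro₁ : Γ ⊢N3 A → Γ ⊢N3 (A ∨ₙ B)
∨-intro₁ = mp (N6 _ _)

∨-intro₂ : Γ ⊢N3 B → Γ ⊢N3 (A ∨ₙ B)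
∨-intro₂ = mp (N7 _ _)

∨-elim : Γ ⊢N3 (A ∨ₙ B) → (Γ ▸ A) ⊢N3 W → (Γ ▸ B) ⊢N3 W → Γ ⊢N3 W
∨-elim d e f = mp (mp (mp (N8 _ _ _) (deduction e)) (deduction f)) d

-- Ex falso, axiom N13: the one place where N3 goes beyond N4.
explode : Γ ⊢N3 (¬ₙ A) → Γ ⊢N3 A → Γ ⊢N3 W
explode n a = mp (mp (N13 _ _) n) a

⟷-to : Γ ⊢N3 (A ⟷ B) → Γ ⊢N3 A → Γ ⊢N3 B
⟷-to e = mp (∧-elim₁ e)

⟷-from : Γ ⊢N3 (A ⟷ B) → Γ ⊢N3 B → Γ ⊢N3 A
⟷-from e = mp (∧-elim₂ e)

¬¬-elim : Γ ⊢N3 (¬ₙ ¬ₙ A) → Γ ⊢N3 A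
¬¬-elim = ⟷-to (N9 _)

¬¬-intro : Γ ⊢N3 A → Γ ⊢N3 (¬ₙ ¬ₙ A)
¬¬-intro = ⟷-from (N9 _)

¬∨-elim : Γ ⊢N3 (¬ₙ (A ∨ₙ B)) → Γ ⊢N3 (¬ₙ A ∧ₙ ¬ₙ B)
¬∨-elim = ⟷-to (N10 _ _)

¬∨-intro : Γ ⊢N3 (¬ₙ A ∧ₙ ¬ₙ B) → Γ ⊢N3 (¬ₙ (A ∨ₙ B))
¬∨-intro = ⟷-from (N10 _ _)

¬∧-elim : Γ ⊢N3 (¬ₙ (A ∧ₙ B)) → Γ ⊢N3 (¬ₙ A ∨ₙ ¬ₙ B)
¬∧-elim = ⟷-to (N11 _ _)

¬∧-intro : Γ ⊢N3 (¬ₙ A ∨ₙ ¬ₙ B) → Γ ⊢N3 (¬ₙ (A ∧ₙ B))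
¬∧-intro = ⟷-from (N11 _ _)

¬⟶-elim : Γ ⊢N3 (¬ₙ (A ⟶ B)) → Γ ⊢N3 (A ∧ₙ ¬ₙ B)
¬⟶-elim = ⟷-to (N12 _ _)

¬⟶-intro : Γ ⊢N3 (A ∧ₙ ¬ₙ B) → Γ ⊢N3 (¬ₙ (A ⟶ B))
¬⟶-intro = ⟷-from (N12 _ _)

⇛-intro : (Γ ▸ A) ⊢N3 B → (Γ ▸ ¬ₙ B) ⊢N3 (¬ₙ A) → Γ ⊢N3 (A ⇛ B)
⇛-intro p q = ∧-intro (deduction p) (deduction q)

⇛-mp : Γ ⊢N3 (A ⇛ B) → Γ ⊢N3 A → Γ ⊢N3 B
⇛-mp h = mp (∧-elim₁ h)

⇛-mt : Γ ⊢N3 (A ⇛ B) → Γ ⊢N3 (¬ₙ B) → Γ ⊢N3 (¬ₙ A)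
⇛-mt h = mp (∧-elim₂ h)

-- A negated strong implication means the same as a negated weak one:
-- ¬(A ⇛ B) ⟷ A ∧ ¬B; the second disjunct of N11 gives ¬B ∧ ¬¬A.
¬⇛-elim : Γ ⊢N3 (¬ₙ (A ⇛ B)) → Γ ⊢N3 (A ∧ₙ ¬ₙ B)
¬⇛-elim d = ∨-elim (¬∧-elim d)
  (¬⟶-elim hyp)
  (∧-intro (¬¬-elim (∧-elim₂ (¬⟶-elim hyp))) (∧-elim₁ (¬⟶-elim hyp)))

¬⇛-intro : Γ ⊢N3 A → Γ ⊢N3 (¬ₙ B) → Γ ⊢N3 (¬ₙ (A ⇛ B))
¬⇛-intro a nb = ¬∧-intro (∨-intro₁ (¬⟶-intro (∧-intro a nb)))

-- Doubled strong implication A ⇛ (A ⇛ W) is the "contractive" implication: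
-- it holds as soon as W is derivable from A, and it can be discharged by A.
⇛²-intro : (Γ ▸ A) ⊢N3 W → Γ ⊢N3 (A ⇛ (A ⇛ W))
⇛²-intro w = ⇛-intro
  (⇛-intro (wk w) (explode hyp (wk w)))
  (explode (∧-elim₂ (¬⇛-elim hyp)) (mp (wk (deduction w)) (∧-elim₁ (¬⇛-elim hyp))))

⇛²-elim : Γ ⊢N3 (A ⇛ (A ⇛ W)) → Γ ⊢N3 A → Γ ⊢N3 W
⇛²-elim h a = ⇛-mp (⇛-mp h a) a

⇛-refl : Γ ⊢N3 (A ⇛ A)
⇛-refl = ⇛-intro hyp hyp

⇛-trans : Γ ⊢N3 (X ⇛ Y) → Γ ⊢N3 (Y ⇛ Z) → Γ ⊢N3 (X ⇛ Z)
⇛-trans h g = ⇛-intro (⇛-mp (wk g) (⇛-mp (wk h) hyp)) (⇛-mt (wk h) (⇛-mt (wk g) hyp))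

⇛-monoʳ : Γ ⊢N3 (X ⇛ Y) → Γ ⊢N3 ((A ⇛ X) ⇛ (A ⇛ Y))
⇛-monoʳ h = ⇛-intro
  (⇛-intro (⇛-mp (wk (wk h)) (⇛-mp (wk hyp) hyp)) (⇛-mt (wk hyp) (⇛-mt (wk (wk h)) hyp)))
  (¬⇛-intro (∧-elim₁ (¬⇛-elim hyp)) (⇛-mt (wk h) (∧-elim₂ (¬⇛-elim hyp))))

⇛²-mono : Γ ⊢N3 (X ⟶ Y) → Γ ⊢N3 ((A ⇛ (A ⇛ X)) ⟶ (A ⇛ (A ⇛ Y)))
⇛²-mono h = deduction (⇛²-intro (mp (wk (wk h)) (⇛²-elim (wk hyp) hyp)))

⇛-exchange : Γ ⊢N3 ((A ⇛ (B ⇛ W)) ⇛ (B ⇛ (A ⇛ W)))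
⇛-exchange = ⇛-intro
  (⇛-intro
    (⇛-intro (⇛-mp (⇛-mp (wk (wk hyp)) hyp) (wk hyp)) (⇛-mt (wk (wk hyp)) (¬⇛-intro (wk hyp) hyp)))
    (⇛-mt (⇛-mp (wk hyp) (∧-elim₁ (¬⇛-elim hyp))) (∧-elim₂ (¬⇛-elim hyp))))
  (¬⇛-intro (∧-elim₁ (¬⇛-elim (∧-elim₂ (¬⇛-elim hyp))))
            (¬⇛-intro (∧-elim₁ (¬⇛-elim hyp)) (∧-elim₂ (¬⇛-elim (∧-elim₂ (¬⇛-elim hyp))))))

⇛-∧-distrib : Γ ⊢N3 (((A ⇛ X) ∧ₙ (A ⇛ Y)) ⇛ (A ⇛ (X ∧ₙ Y)))
⇛-∧-distrib = ⇛-intro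
  (⇛-intro (∧-intro (⇛-mp (∧-elim₁ (wk hyp)) hyp) (⇛-mp (∧-elim₂ (wk hyp)) hyp))
           (∨-elim (¬∧-elim hyp) (⇛-mt (∧-elim₁ (wk (wk hyp))) hyp) (⇛-mt (∧-elim₂ (wk (wk hyp))) hyp)))
  (¬∧-intro (∨-elim (¬∧-elim (∧-elim₂ (¬⇛-elim hyp)))
    (∨-intro₁ (¬⇛-intro (∧-elim₁ (¬⇛-elim (wk hyp))) hyp))
    (∨-intro₂ (¬⇛-intro (∧-elim₁ (¬⇛-elim (wk hyp))) hyp))))

⇛-const : Γ ⊢N3 W → Γ ⊢N3 (A ⇛ W)
⇛-const d = ⇛-intro (wk d) (explode hyp (wk d))

⇛-mp-internal : Γ ⊢N3 (B ⇛ W) → Γ ⊢N3 (A ⇛ ((A ⇛ B) ⇛ W))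
⇛-mp-internal h = ⇛-intro
  (⇛-intro (⇛-mp (wk (wk h)) (⇛-mp hyp (wk hyp))) (¬⇛-intro (wk hyp) (⇛-mt (wk (wk h)) hyp)))
  (⇛-mt (∧-elim₁ (¬⇛-elim hyp)) (⇛-mt (wk h) (∧-elim₂ (¬⇛-elim hyp))))

∧-⇛₁ : Γ ⊢N3 (A ⇛ W) → Γ ⊢N3 ((A ∧ₙ B) ⇛ W)
∧-⇛₁ h = ⇛-intro (⇛-mp (wk h) (∧-elim₁ hyp)) (¬∧-intro (∨-intro₁ (⇛-mt (wk h) hyp)))

∧-⇛₂ : Γ ⊢N3 (B ⇛ W) → Γ ⊢N3 ((A ∧ₙ B) ⇛ W)
∧-⇛₂ h = ⇛-intro (⇛-mp (wk h) (∧-elim₂ hyp)) (¬∧-intro (∨-intro₂ (⇛-mt (wk h) hyp)))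

∨-⇛ : Γ ⊢N3 (A ⇛ W) → Γ ⊢N3 (B ⇛ W) → Γ ⊢N3 ((A ∨ₙ B) ⇛ W)
∨-⇛ h g = ⇛-intro (∨-elim hyp (⇛-mp (wk (wk h)) hyp) (⇛-mp (wk (wk g)) hyp))
                  (¬∨-intro (∧-intro (⇛-mt (wk h) hyp) (⇛-mt (wk g) hyp)))

∨-⇛² : Γ ⊢N3 (A ⇛ (A ⇛ W)) → Γ ⊢N3 (B ⇛ (B ⇛ W)) → Γ ⊢N3 ((A ∨ₙ B) ⇛ ((A ∨ₙ B) ⇛ W))
∨-⇛² h g = ⇛²-intro (∨-elim hyp (⇛²-elim (wk (wk h)) hyp) (⇛²-elim (wk (wk g)) hyp))

⇛-∨₁ : Γ ⊢N3 (A ⇛ (A ∨ₙ B))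
⇛-∨₁ = ⇛-intro (∨-intro₁ hyp) (∧-elim₁ (¬∨-elim hyp))

⇛-∨₂ : Γ ⊢N3 (B ⇛ (A ∨ₙ B))
⇛-∨₂ = ⇛-intro (∨-intro₂ hyp) (∧-elim₂ (¬∨-elim hyp))

𝟘-⇛ : Γ ⊢N3 (𝟘ₙ ⇛ A)
𝟘-⇛ = ⇛-intro (explode (∧-elim₂ (¬⟶-elim hyp)) (∧-elim₁ (¬⟶-elim hyp))) (¬¬-intro (⟶-refl _))

𝟙-holds : Γ ⊢N3 (¬ₙ 𝟘ₙ)
𝟙-holds = ¬¬-intro (⟶-refl _)

¬-⇛-𝟘 : Γ ⊢N3 (¬ₙ A ⇛ (A ⇛ 𝟘ₙ))
¬-⇛-𝟘 = ⇛-intro (⇛-intro (explode (wk hyp) hyp) (wk hyp)) (¬¬-intro (∧-elim₁ (¬⇛-elim hyp)))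

⇛-contrapose : Γ ⊢N3 ((A ⇛ B) ⇛ (¬ₙ B ⇛ ¬ₙ A))
⇛-contrapose = ⇛-intro
  (⇛-intro (⇛-mt (wk hyp) hyp) (¬¬-intro (⇛-mp (wk hyp) (¬¬-elim hyp))))
  (¬⇛-intro (¬¬-elim (∧-elim₂ (¬⇛-elim hyp))) (∧-elim₁ (¬⇛-elim hyp)))

⇛-uncontrapose : Γ ⊢N3 ((¬ₙ B ⇛ ¬ₙ A) ⇛ (A ⇛ B))
⇛-uncontrapose = ⇛-intro
  (⇛-intro (¬¬-elim (⇛-mt (wk hyp) (¬¬-intro hyp))) (⇛-mp (wk hyp) hyp))
  (¬⇛-intro (∧-elim₂ (¬⇛-elim hyp)) (¬¬-intro (∧-elim₁ (¬⇛-elim hyp))))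

-- The De Morgan laws N9–N12 hold in the strong form as well (the negative
-- half of each ⇛ uses the opposite law).
¬⇛-unfold : Γ ⊢N3 (¬ₙ (A ⇛ B) ⇛ (A ∧ₙ ¬ₙ B))
¬⇛-unfold = ⇛-intro (¬⇛-elim hyp)
  (¬¬-intro (∨-elim (¬∧-elim hyp) (⇛-intro (explode (wk hyp) hyp) (wk hyp))
                                  (⇛-intro (¬¬-elim (wk hyp)) (explode hyp (¬¬-elim (wk hyp))))))

¬∧-unfold : Γ ⊢N3 (¬ₙ (A ∧ₙ B) ⇛ (¬ₙ A ∨ₙ ¬ₙ B))
¬∧-unfold = ⇛-intro (¬∧-elim hyp) (¬¬-intro (∧-intro (¬¬-elim (∧-elim₁ (¬∨-elim hyp))) (¬¬-elim (∧-elim₂ (¬∨-elim hyp)))))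

¬∧-fold : Γ ⊢N3 ((¬ₙ A ∨ₙ ¬ₙ B) ⇛ ¬ₙ (A ∧ₙ B))
¬∧-fold = ⇛-intro (¬∧-intro hyp) (¬∨-intro (∧-intro (¬¬-intro (∧-elim₁ (¬¬-elim hyp))) (¬¬-intro (∧-elim₂ (¬¬-elim hyp)))))

¬∨-unfold : Γ ⊢N3 (¬ₙ (A ∨ₙ B) ⇛ (¬ₙ A ∧ₙ ¬ₙ B))
¬∨-unfold = ⇛-intro (¬∨-elim hyp) (¬¬-intro (∨-elim (¬∧-elim hyp) (∨-intro₁ (¬¬-elim hyp)) (∨-intro₂ (¬¬-elim hyp))))

¬∨-fold : Γ ⊢N3 ((¬ₙ A ∧ₙ ¬ₙ B) ⇛ ¬ₙ (A ∨ₙ B))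
¬∨-fold = ⇛-intro (¬∨-intro hyp) (¬∧-intro (∨-elim (¬¬-elim hyp) (∨-intro₁ (¬¬-intro hyp)) (∨-intro₂ (¬¬-intro hyp))))

¬¬-unfold : Γ ⊢N3 (¬ₙ ¬ₙ A ⇛ A)
¬¬-unfold = ⇛-intro (¬¬-elim hyp) (¬¬-intro hyp)

¬¬-fold : Γ ⊢N3 (A ⇛ ¬ₙ ¬ₙ A)
¬¬-fold = ⇛-intro (¬¬-intro hyp) (¬¬-elim hyp)

⇛-under : ∀ Δ (φ γ : SFm) → Γ ⊢N3 (tr φ ⇛ tr γ) → Γ ⊢N3 (tr (Δ ⇒* φ) ⇛ tr (Δ ⇒* γ))
⇛-under []      φ γ h = h
⇛-under (a ∷ Δ) φ γ h = ⇛-monoʳ (⇛-under Δ φ γ h)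

⇛-mp-under : ∀ Δ (φ γ : SFm) → Γ ⊢N3 (tr φ ⇛ tr γ) → Γ ⊢N3 tr (Δ ⇒* φ) → Γ ⊢N3 tr (Δ ⇒* γ)
⇛-mp-under Δ φ γ h = ⇛-mp (⇛-under Δ φ γ h)

⟶-under² : ∀ Δ (φ γ : SFm) → Γ ⊢N3 (tr φ ⟶ tr γ) → Γ ⊢N3 (tr (Δ ⇒²* φ) ⟶ tr (Δ ⇒²* γ))
⟶-under² []      φ γ h = h
⟶-under² (a ∷ Δ) φ γ h = ⇛²-mono (⟶-under² Δ φ γ h)

∧-under : ∀ Δ (φ ψ : SFm) → Γ ⊢N3 ((tr (Δ ⇒* φ) ∧ₙ tr (Δ ⇒* ψ)) ⇛ tr (Δ ⇒* (φ ∧ ψ)))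
∧-under []      φ ψ = ⇛-refl
∧-under (a ∷ Δ) φ ψ = ⇛-trans ⇛-∧-distrib (⇛-monoʳ (∧-under Δ φ ψ))

S⊆N3 : ∀ {G : SFm → Set} {φ} → G ⊢S φ → trSet G ⊢N3 tr φ
S⊆N3 (prem {φ} g)        = prem (φ , g , refl)
S⊆N3 (A1 φ)              = ⇛-refl
S⊆N3 (A2 ψ)              = 𝟘-⇛
S⊆N3 (A3 φ)              = ¬-⇛-𝟘
S⊆N3 A4                  = 𝟙-holds
S⊆N3 (A5 φ ψ)            = ∧-intro ⇛-contrapose ⇛-uncontrapose
S⊆N3 (P Δ φ ψ γ d)       = ⇛-mp-under Δ (φ ⇒ (ψ ⇒ γ)) (ψ ⇒ (φ ⇒ γ)) ⇛-exchange (S⊆N3 d)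
S⊆N3 (C φ γ d)           = ⇛²-intro (⇛-mp (⇛²-elim (wk (S⊆N3 d)) hyp) hyp)
S⊆N3 (E Δ φ γ d e)       = ⇛-mp-under Δ φ γ (S⊆N3 e) (S⊆N3 d)
S⊆N3 (⇒l Δ φ ψ γ d e)    = ⇛-mp-under Δ φ ((φ ⇒ ψ) ⇒ γ) (⇛-mp-internal (S⊆N3 e)) (S⊆N3 d)
S⊆N3 (⇒r φ γ d)          = ⇛-const (S⊆N3 d)
S⊆N3 (∧l1 φ ψ γ d)       = ∧-⇛₁ (S⊆N3 d)
S⊆N3 (∧l2 φ ψ γ d)       = ∧-⇛₂ (S⊆N3 d)
S⊆N3 (∧r Δ φ ψ d e)      = ⇛-mp (∧-under Δ φ ψ) (∧-intro (S⊆N3 d) (S⊆N3 e))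
S⊆N3 (∨l1 φ ψ γ d e)     = ∨-⇛ (S⊆N3 d) (S⊆N3 e)
S⊆N3 (∨l2 φ ψ γ d e)     = ∨-⇛² (S⊆N3 d) (S⊆N3 e)
S⊆N3 (∨r1 Δ φ ψ d)       = ⇛-mp-under Δ φ (φ ∨ ψ) ⇛-∨₁ (S⊆N3 d)
S⊆N3 (∨r2 Δ φ ψ d)       = ⇛-mp-under Δ ψ (φ ∨ ψ) ⇛-∨₂ (S⊆N3 d)
S⊆N3 (¬⇒l φ ψ γ d)       = ⇛-trans ¬⇛-unfold (S⊆N3 d)
S⊆N3 (¬⇒r Δ φ ψ d)       =
  mp (⟶-under² Δ (φ ∧ ¬ ψ) (¬ (φ ⇒ ψ)) (deduction (¬⇛-intro (∧-elim₁ hyp) (∧-elim₂ hyp)))) (S⊆N3 d)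
S⊆N3 (¬∧l φ ψ γ d)       = ⇛-trans ¬∧-unfold (S⊆N3 d)
S⊆N3 (¬∧r Δ φ ψ d)       = ⇛-mp-under Δ (¬ φ ∨ ¬ ψ) (¬ (φ ∧ ψ)) ¬∧-fold (S⊆N3 d)
S⊆N3 (¬∨l φ ψ γ d)       = ⇛-trans ¬∨-unfold (S⊆N3 d)
S⊆N3 (¬∨r Δ φ ψ d)       = ⇛-mp-under Δ (¬ φ ∧ ¬ ψ) (¬ (φ ∨ ψ)) ¬∨-fold (S⊆N3 d)
S⊆N3 (¬¬l φ γ d)         = ⇛-trans ¬¬-unfold (S⊆N3 d)
S⊆N3 (¬¬r Δ φ d)         = ⇛-mp-under Δ φ (¬ ¬ φ) ¬¬-fold (S⊆N3 d)

-- A six-element model of S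

Val : Set
Val = Fin 6

pattern v0 = zero
pattern v1 = suc zero
pattern v2 = suc (suc zero)
pattern v3 = suc (suc (suc zero))
pattern v4 = suc (suc (suc (suc zero)))
pattern v5 = suc (suc (suc (suc (suc zero))))

infixr 6 _⊔_
infixr 7 _⊓_
infixl 7 _·_
infixr 5 _⊸_
infix 8 ∼_

_⊓_ _⊔_ : Val → Val → Val
x ⊓ y = if toℕ x ≤ᵇ toℕ y then x else y
x ⊔ y = if toℕ x ≤ᵇ toℕ y then y else x

∼_ : Val → Val
∼_ = opposite

-- A commutative monoid with unit v5 and absorbing element v0.  It is not
-- idempotent (v4 · v4 = v3), so x ⇒ (x ⇒ y) does not force x ⇒ y.
_·_ : Val → Val → Val
v5 · y  = y
x  · v5 = x
v4 · v4 = v3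
v4 · v3 = v3
v3 · v4 = v3
v3 · v3 = v3
v4 · v2 = v1
v2 · v4 = v1
_  · _  = v0

_⊸_ : Val → Val → Val
x ⊸ y = ∼ (x · ∼ y)

designated? : (x : Val) → Dec (x ≡ v5)
designated? x = x ≟ v5

⊸-refl : ∀ a → a ⊸ a ≡ v5
⊸-refl = from-yes (all? λ a → designated? (a ⊸ a))

v0-⊸ : ∀ a → v0 ⊸ a ≡ v5
v0-⊸ = from-yes (all? λ a → designated? (v0 ⊸ a))

∼-⊸-v0 : ∀ a → ∼ a ⊸ (a ⊸ v0) ≡ v5
∼-⊸-v0 = from-yes (all? λ a → designated? (∼ a ⊸ (a ⊸ v0)))

contrapose : ∀ a b → ((a ⊸ b) ⊸ (∼ b ⊸ ∼ a)) ⊓ ((∼ b ⊸ ∼ a) ⊸ (a ⊸ b)) ≡ v5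
contrapose = from-yes (all? λ a → all? λ b →
  designated? (((a ⊸ b) ⊸ (∼ b ⊸ ∼ a)) ⊓ ((∼ b ⊸ ∼ a) ⊸ (a ⊸ b))))

exchange : ∀ a b c → (a ⊸ (b ⊸ c)) ⊸ (b ⊸ (a ⊸ c)) ≡ v5
exchange = from-yes (all? λ a → all? λ b → all? λ c →
  designated? ((a ⊸ (b ⊸ c)) ⊸ (b ⊸ (a ⊸ c))))

-- The model is 3-potent: a ⊸ (a ⊸ (a ⊸ c)) designated forces a ⊸ (a ⊸ c).
contract : ∀ a c → a ⊸ (a ⊸ (a ⊸ c)) ≡ v5 → a ⊸ (a ⊸ c) ≡ v5
contract = from-yes (all? λ a → all? λ c →
  designated? (a ⊸ (a ⊸ (a ⊸ c))) →-dec designated? (a ⊸ (a ⊸ c)))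

⊸-mp-internal : ∀ a b c → b ⊸ c ≡ v5 → a ⊸ ((a ⊸ b) ⊸ c) ≡ v5
⊸-mp-internal = from-yes (all? λ a → all? λ b → all? λ c →
  designated? (b ⊸ c) →-dec designated? (a ⊸ ((a ⊸ b) ⊸ c)))

⊸-const : ∀ a c → c ≡ v5 → a ⊸ c ≡ v5
⊸-const = from-yes (all? λ a → all? λ c → designated? c →-dec designated? (a ⊸ c))

⊓-⊸₁ : ∀ a b c → a ⊸ c ≡ v5 → (a ⊓ b) ⊸ c ≡ v5
⊓-⊸₁ = from-yes (all? λ a → all? λ b → all? λ c →
  designated? (a ⊸ c) →-dec designated? ((a ⊓ b) ⊸ c))

⊓-⊸₂ : ∀ a b c → b ⊸ c ≡ v5 → (a ⊓ b) ⊸ c ≡ v5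
⊓-⊸₂ = from-yes (all? λ a → all? λ b → all? λ c →
  designated? (b ⊸ c) →-dec designated? ((a ⊓ b) ⊸ c))

⊔-⊸ : ∀ a b c → a ⊸ c ≡ v5 → b ⊸ c ≡ v5 → (a ⊔ b) ⊸ c ≡ v5
⊔-⊸ = from-yes (all? λ a → all? λ b → all? λ c →
  designated? (a ⊸ c) →-dec designated? (b ⊸ c) →-dec designated? ((a ⊔ b) ⊸ c))

⊔-⊸² : ∀ a b c → a ⊸ (a ⊸ c) ≡ v5 → b ⊸ (b ⊸ c) ≡ v5 → (a ⊔ b) ⊸ ((a ⊔ b) ⊸ c) ≡ v5
⊔-⊸² = from-yes (all? λ a → all? λ b → all? λ c →
  designated? (a ⊸ (a ⊸ c)) →-dec designated? (b ⊸ (b ⊸ c)) →-dec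
  designated? ((a ⊔ b) ⊸ ((a ⊔ b) ⊸ c)))

⊸-⊔₁ : ∀ a b → a ⊸ (a ⊔ b) ≡ v5
⊸-⊔₁ = from-yes (all? λ a → all? λ b → designated? (a ⊸ (a ⊔ b)))

⊸-⊔₂ : ∀ a b → b ⊸ (a ⊔ b) ≡ v5
⊸-⊔₂ = from-yes (all? λ a → all? λ b → designated? (b ⊸ (a ⊔ b)))

∼⊸-⊸ : ∀ a b c → (a ⊓ ∼ b) ⊸ c ≡ v5 → ∼ (a ⊸ b) ⊸ c ≡ v5
∼⊸-⊸ = from-yes (all? λ a → all? λ b → all? λ c →
  designated? ((a ⊓ ∼ b) ⊸ c) →-dec designated? (∼ (a ⊸ b) ⊸ c))

∼⊓-⊸ : ∀ a b c → (∼ a ⊔ ∼ b) ⊸ c ≡ v5 → ∼ (a ⊓ b) ⊸ c ≡ v5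
∼⊓-⊸ = from-yes (all? λ a → all? λ b → all? λ c →
  designated? ((∼ a ⊔ ∼ b) ⊸ c) →-dec designated? (∼ (a ⊓ b) ⊸ c))

∼⊔-⊸ : ∀ a b c → (∼ a ⊓ ∼ b) ⊸ c ≡ v5 → ∼ (a ⊔ b) ⊸ c ≡ v5
∼⊔-⊸ = from-yes (all? λ a → all? λ b → all? λ c →
  designated? ((∼ a ⊓ ∼ b) ⊸ c) →-dec designated? (∼ (a ⊔ b) ⊸ c))

∼∼-⊸ : ∀ a c → a ⊸ c ≡ v5 → ∼ ∼ a ⊸ c ≡ v5
∼∼-⊸ = from-yes (all? λ a → all? λ c → designated? (a ⊸ c) →-dec designated? (∼ ∼ a ⊸ c))

⊸-∼⊓ : ∀ a b → (∼ a ⊔ ∼ b) ⊸ ∼ (a ⊓ b) ≡ v5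
⊸-∼⊓ = from-yes (all? λ a → all? λ b → designated? ((∼ a ⊔ ∼ b) ⊸ ∼ (a ⊓ b)))

⊸-∼⊔ : ∀ a b → (∼ a ⊓ ∼ b) ⊸ ∼ (a ⊔ b) ≡ v5
⊸-∼⊔ = from-yes (all? λ a → all? λ b → designated? ((∼ a ⊓ ∼ b) ⊸ ∼ (a ⊔ b)))

⊸-∼∼ : ∀ a → a ⊸ ∼ ∼ a ≡ v5
⊸-∼∼ = from-yes (all? λ a → designated? (a ⊸ ∼ ∼ a))

residuation : ∀ a b c → a ⊸ (b ⊸ c) ≡ (a · b) ⊸ c
residuation = from-yes (all? λ a → all? λ b → all? λ c → a ⊸ (b ⊸ c) ≟ (a · b) ⊸ c)

⊸-monoʳ : ∀ a b c → b ⊸ c ≡ v5 → (a ⊸ b) ⊸ (a ⊸ c) ≡ v5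
⊸-monoʳ = from-yes (all? λ a → all? λ b → all? λ c →
  designated? (b ⊸ c) →-dec designated? ((a ⊸ b) ⊸ (a ⊸ c)))

⊸-⊓-distrib : ∀ a b c → a ⊸ (b ⊓ c) ≡ (a ⊸ b) ⊓ (a ⊸ c)
⊸-⊓-distrib = from-yes (all? λ a → all? λ b → all? λ c → a ⊸ (b ⊓ c) ≟ (a ⊸ b) ⊓ (a ⊸ c))

square-idem : ∀ a d → d · d ≡ d → (a · a · d) · (a · a · d) ≡ a · a · d
square-idem = from-yes (all? λ a → all? λ d →
  d · d ≟ d →-dec (a · a · d) · (a · a · d) ≟ a · a · d)

-- Below an idempotent d, x ⊓ ∼y lies under x · ∼y = ∼(x ⊸ y).
idem-∼⊸ : ∀ d x y → d · d ≡ d → d ⊸ (x ⊓ ∼ y) ≡ v5 → d ⊸ ∼ (x ⊸ y) ≡ v5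
idem-∼⊸ = from-yes (all? λ d → all? λ x → all? λ y →
  d · d ≟ d →-dec designated? (d ⊸ (x ⊓ ∼ y)) →-dec designated? (d ⊸ ∼ (x ⊸ y)))

v5-⊸ : ∀ a → v5 ⊸ a ≡ a
v5-⊸ = opposite-involutive

⊸-mp : ∀ {a b} → a ⊸ b ≡ v5 → a ≡ v5 → b ≡ v5
⊸-mp {b = b} h refl = trans (sym (v5-⊸ b)) h

module Interpretation (v : ℕ → Val) where

  ⟦_⟧ : SFm → Val
  ⟦ var n ⟧ = v n
  ⟦ φ ∧ ψ ⟧ = ⟦ φ ⟧ ⊓ ⟦ ψ ⟧
  ⟦ φ ∨ ψ ⟧ = ⟦ φ ⟧ ⊔ ⟦ ψ ⟧
  ⟦ φ ⇒ ψ ⟧ = ⟦ φ ⟧ ⊸ ⟦ ψ ⟧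
  ⟦ ¬ φ ⟧   = ∼ ⟦ φ ⟧
  ⟦ 𝟘 ⟧     = v0

  ⊸-under : ∀ Δ φ γ → ⟦ φ ⟧ ⊸ ⟦ γ ⟧ ≡ v5 → ⟦ Δ ⇒* φ ⟧ ⊸ ⟦ Δ ⇒* γ ⟧ ≡ v5
  ⊸-under []      φ γ h = h
  ⊸-under (a ∷ Δ) φ γ h = ⊸-monoʳ ⟦ a ⟧ ⟦ Δ ⇒* φ ⟧ ⟦ Δ ⇒* γ ⟧ (⊸-under Δ φ γ h)

  ⊸-mp-under : ∀ Δ φ γ → ⟦ φ ⟧ ⊸ ⟦ γ ⟧ ≡ v5 → ⟦ Δ ⇒* φ ⟧ ≡ v5 → ⟦ Δ ⇒* γ ⟧ ≡ v5
  ⊸-mp-under Δ φ γ h = ⊸-mp (⊸-under Δ φ γ h)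

  ⊓-under : ∀ Δ φ ψ → ⟦ Δ ⇒* (φ ∧ ψ) ⟧ ≡ ⟦ Δ ⇒* φ ⟧ ⊓ ⟦ Δ ⇒* ψ ⟧
  ⊓-under []      φ ψ = refl
  ⊓-under (a ∷ Δ) φ ψ = trans (cong (⟦ a ⟧ ⊸_) (⊓-under Δ φ ψ)) (⊸-⊓-distrib ⟦ a ⟧ ⟦ Δ ⇒* φ ⟧ ⟦ Δ ⇒* ψ ⟧)

  -- A doubled prefix Δ ⇒² _ acts as a single residuation by the product
  -- of the squares of Δ, which is idempotent.
  squares : List SFm → Val
  squares []      = v5
  squares (a ∷ Δ) = ⟦ a ⟧ · ⟦ a ⟧ · squares Δ

  squares-idem : ∀ Δ → squares Δ · squares Δ ≡ squares Δ
  squares-idem []      = refl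
  squares-idem (a ∷ Δ) = square-idem ⟦ a ⟧ (squares Δ) (squares-idem Δ)

  ⇒²-under : ∀ Δ u → ⟦ Δ ⇒²* u ⟧ ≡ squares Δ ⊸ ⟦ u ⟧
  ⇒²-under []      u = sym (v5-⊸ ⟦ u ⟧)
  ⇒²-under (a ∷ Δ) u = begin
    ⟦ a ⟧ ⊸ (⟦ a ⟧ ⊸ ⟦ Δ ⇒²* u ⟧)          ≡⟨ cong (λ t → ⟦ a ⟧ ⊸ (⟦ a ⟧ ⊸ t)) (⇒²-under Δ u) ⟩
    ⟦ a ⟧ ⊸ (⟦ a ⟧ ⊸ (squares Δ ⊸ ⟦ u ⟧))  ≡⟨ residuation ⟦ a ⟧ ⟦ a ⟧ (squares Δ ⊸ ⟦ u ⟧) ⟩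
    (⟦ a ⟧ · ⟦ a ⟧) ⊸ (squares Δ ⊸ ⟦ u ⟧)  ≡⟨ residuation (⟦ a ⟧ · ⟦ a ⟧) (squares Δ) ⟦ u ⟧ ⟩
    squares (a ∷ Δ) ⊸ ⟦ u ⟧                 ∎
    where open ≡-Reasoning

  S-sound : ∀ {G : SFm → Set} → (∀ {χ} → G χ → ⟦ χ ⟧ ≡ v5) → ∀ {φ} → G ⊢S φ → ⟦ φ ⟧ ≡ v5
  S-sound hG (prem g)            = hG g
  S-sound hG (A1 φ)              = ⊸-refl ⟦ φ ⟧
  S-sound hG (A2 ψ)              = v0-⊸ ⟦ ψ ⟧
  S-sound hG (A3 φ)              = ∼-⊸-v0 ⟦ φ ⟧
  S-sound hG A4                  = refl
  S-sound hG (A5 φ ψ)            = contrapose ⟦ φ ⟧ ⟦ ψ ⟧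
  S-sound hG (P Δ φ ψ γ d)       = ⊸-mp-under Δ (φ ⇒ (ψ ⇒ γ)) (ψ ⇒ (φ ⇒ γ)) (exchange ⟦ φ ⟧ ⟦ ψ ⟧ ⟦ γ ⟧) (S-sound hG d)
  S-sound hG (C φ γ d)           = contract ⟦ φ ⟧ ⟦ γ ⟧ (S-sound hG d)
  S-sound hG (E Δ φ γ d e)       = ⊸-mp-under Δ φ γ (S-sound hG e) (S-sound hG d)
  S-sound hG (⇒l Δ φ ψ γ d e)    =
    ⊸-mp-under Δ φ ((φ ⇒ ψ) ⇒ γ) (⊸-mp-internal ⟦ φ ⟧ ⟦ ψ ⟧ ⟦ γ ⟧ (S-sound hG e)) (S-sound hG d)
  S-sound hG (⇒r φ γ d)          = ⊸-const ⟦ φ ⟧ ⟦ γ ⟧ (S-sound hG d)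
  S-sound hG (∧l1 φ ψ γ d)       = ⊓-⊸₁ ⟦ φ ⟧ ⟦ ψ ⟧ ⟦ γ ⟧ (S-sound hG d)
  S-sound hG (∧l2 φ ψ γ d)       = ⊓-⊸₂ ⟦ φ ⟧ ⟦ ψ ⟧ ⟦ γ ⟧ (S-sound hG d)
  S-sound hG (∧r Δ φ ψ d e)      =
    trans (⊓-under Δ φ ψ) (cong₂ _⊓_ (S-sound hG d) (S-sound hG e))
  S-sound hG (∨l1 φ ψ γ d e)     = ⊔-⊸ ⟦ φ ⟧ ⟦ ψ ⟧ ⟦ γ ⟧ (S-sound hG d) (S-sound hG e)
  S-sound hG (∨l2 φ ψ γ d e)     = ⊔-⊸² ⟦ φ ⟧ ⟦ ψ ⟧ ⟦ γ ⟧ (S-sound hG d) (S-sound hG e)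
  S-sound hG (∨r1 Δ φ ψ d)       = ⊸-mp-under Δ φ (φ ∨ ψ) (⊸-⊔₁ ⟦ φ ⟧ ⟦ ψ ⟧) (S-sound hG d)
  S-sound hG (∨r2 Δ φ ψ d)       = ⊸-mp-under Δ ψ (φ ∨ ψ) (⊸-⊔₂ ⟦ φ ⟧ ⟦ ψ ⟧) (S-sound hG d)
  S-sound hG (¬⇒l φ ψ γ d)       = ∼⊸-⊸ ⟦ φ ⟧ ⟦ ψ ⟧ ⟦ γ ⟧ (S-sound hG d)
  S-sound hG (¬⇒r Δ φ ψ d)       = trans (⇒²-under Δ (¬ (φ ⇒ ψ))) (
    idem-∼⊸ (squares Δ) ⟦ φ ⟧ ⟦ ψ ⟧ (squares-idem Δ) (trans (sym (⇒²-under Δ (φ ∧ ¬ ψ))) (S-sound hG d)))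
  S-sound hG (¬∧l φ ψ γ d)       = ∼⊓-⊸ ⟦ φ ⟧ ⟦ ψ ⟧ ⟦ γ ⟧ (S-sound hG d)
  S-sound hG (¬∧r Δ φ ψ d)       = ⊸-mp-under Δ (¬ φ ∨ ¬ ψ) (¬ (φ ∧ ψ)) (⊸-∼⊓ ⟦ φ ⟧ ⟦ ψ ⟧) (S-sound hG d)
  S-sound hG (¬∨l φ ψ γ d)       = ∼⊔-⊸ ⟦ φ ⟧ ⟦ ψ ⟧ ⟦ γ ⟧ (S-sound hG d)
  S-sound hG (¬∨r Δ φ ψ d)       = ⊸-mp-under Δ (¬ φ ∧ ¬ ψ) (¬ (φ ∨ ψ)) (⊸-∼⊔ ⟦ φ ⟧ ⟦ ψ ⟧) (S-sound hG d)
  S-sound hG (¬¬l φ γ d)         = ∼∼-⊸ ⟦ φ ⟧ ⟦ γ ⟧ (S-sound hG d)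
  S-sound hG (¬¬r Δ φ d)         = ⊸-mp-under Δ φ (¬ ¬ φ) (⊸-∼∼ ⟦ φ ⟧) (S-sound hG d)

p q : SFm
p = var 1
q = var 2

premisses : SFm → Set
premisses χ = (χ ≡ (p ⇒ (p ⇒ q))) ⊎ (χ ≡ (¬ q ⇒ (¬ q ⇒ ¬ p)))

-- N3 derives p ⇒ q: both parts of the strong implication follow by
-- contracting a doubled one.
N3-derives : trSet premisses ⊢N3 tr (p ⇒ q)
N3-derives = ⇛-intro (⇛²-elim (wk positive) hyp) (⇛²-elim (wk negative) hyp)
  where
  positive : trSet premisses ⊢N3 tr (p ⇒ (p ⇒ q))
  positive = prem (_ , inj₁ refl , refl)
  negative : trSet premisses ⊢N3 tr (¬ q ⇒ (¬ q ⇒ ¬ p))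
  negative = prem (_ , inj₂ refl , refl)

-- S does not: the valuation p = v2, q = v1 designates both premisses,
-- while p ⇒ q evaluates to v2 ⊸ v1 = v4.
separating-valuation : ℕ → Val
separating-valuation 1 = v2
separating-valuation 2 = v1
separating-valuation _ = v5

open Interpretation separating-valuation

premisses-designated : ∀ {χ} → premisses χ → ⟦ χ ⟧ ≡ v5
premisses-designated (inj₁ refl) = refl
premisses-designated (inj₂ refl) = refl

S-underives : Not (premisses ⊢S (p ⇒ q))
S-underives d with S-sound premisses-designated d
... | ()

proposition6p4 : ((Γ : SFm → Set) (φ : SFm) → Γ ⊢S φ → trSet Γ ⊢N3 tr φ)
                 × Σ (SFm → Set) (λ Γ → Σ SFm (λ φ → (trSet Γ ⊢N3 tr φ) × Not (Γ ⊢S φ)))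
proposition6p4 = (λ Γ φ → S⊆N3) , premisses , (p ⇒ q) , N3-derives , S-underives
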